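{- Let $m,n$ be positive integers. The number of marked binary necklaces of type $(m,n)$ equals \[ \frac{\gcd(m,n)}{m+n}\binom{m+n}{n}. \]
   Context: A binary word of type $(m,n)$ is a string of length $m+n$ over the alphabet $\{\circ,\bullet\}$ with $m$ occurrences of $\circ$ and $n$ occurrences of $\bullet$; a binary necklace of type $(m,n)$ is an equivalence class of such words under cyclic rotation. Order words lexicographically with $\circ\prec\bullet$, and for a necklace $\omega$ let $s(\omega)$ be the lexicographically minimal word representing $\omega$. Let $g=\frac{m+n}{\gcd(m,n)}$. A block of $\omega$ is a run of $g$ consecutive beads of the necklace whose counterpart in $s(\omega)$ starts at a position congruent to $1$ modulo $g$; thus $s(\omega)$ is cut into $\gcd(m,n)$ blocks. The rotational symmetry group of $\omega$ (the rotations of the $m+n$ positions fixing $\omega$) permutes these blocks; a distinguishable block is an orbit of blocks under this group (i.e. blocks are identified when some rotational symmetry of the necklace maps one to the other). A marked necklace of type $(m,n)$ is a pair consisting of a binary necklace of type $(m,n)$ together with a choice of one distinguishable block. -}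

module Defs where

open import Data.Nat using (ℕ; zero; suc; _+_; _*_; _%_; _/_; _≡ᵇ_; _<ᵇ_)
open import Data.Nat.GCD using (gcd)
open import Data.Bool using (Bool; true; false; _∧_; _∨_; not; if_then_else_)
open import Data.List using (List; []; _∷_; _++_; map; concatMap; filter; length; drop; take; upTo; all; any)
open import Data.Nat.ListAction using (sum)
open import Data.List.Properties using (≡-dec)
import Data.Bool.Properties as BP
open import Relation.Nullary.Decidable using (⌊_⌋)

-- A binary word is a list of Bool; false = ∘ (white bead), true = • (black bead).
-- Lexicographic order is the one with ∘ ≺ •, i.e. false < true.
Word : Set
Word = List Bool

allWords : ℕ → List Word
allWords zero    = [] ∷ []
allWords (suc N) = concatMap (λ w → (false ∷ w) ∷ (true ∷ w) ∷ []) (allWords N)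

blacks : Word → ℕ
blacks w = length (filter (λ b → b BP.≟ true) w)

hasType : ℕ → ℕ → Word → Bool
hasType m n w = (blacks w ≡ᵇ n) ∧ (length w ≡ᵇ m + n)

lexLeq : Word → Word → Bool
lexLeq []          _           = true
lexLeq (_ ∷ _)     []          = false
lexLeq (false ∷ u) (true ∷ v)  = true
lexLeq (true ∷ u)  (false ∷ v) = false
lexLeq (false ∷ u) (false ∷ v) = lexLeq u v
lexLeq (true ∷ u)  (true ∷ v)  = lexLeq u v

-- cyclic rotation by k positions (k < length w): position p of the result
-- holds position p + k of w
rotate : ℕ → Word → Word
rotate k w = drop k w ++ take k w

wordEq : Word → Word → Bool
wordEq u v = ⌊ ≡-dec BP._≟_ u v ⌋

isMinRep : Word → Bool
isMinRep w = all (λ k → lexLeq w (rotate k w)) (upTo (length w))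

isSymmetry : Word → ℕ → Bool
isSymmetry w r = wordEq (rotate r w) w

divOr0 : ℕ → ℕ → ℕ
divOr0 a zero    = 0
divOr0 a (suc d) = a / suc d

-- block length g = (m+n)/gcd(m,n); block i (0 ≤ i < gcd(m,n)) of s(ω)
-- starts at (0-based) position i * g
blockLen : ℕ → ℕ → ℕ
blockLen m n = divOr0 (m + n) (gcd m n)

modOr0 : ℕ → ℕ → ℕ
modOr0 a zero    = 0
modOr0 a (suc N) = a % suc N

-- blocks j and i of the minimal representative w (type (m,n)) are identified:
-- some rotational symmetry of the necklace maps block j onto block i
-- (i.e. moves the start position of block j to the start position of block i)
sameBlockOrbit : ℕ → ℕ → Word → ℕ → ℕ → Bool
sameBlockOrbit m n w j i =
  any (λ r → isSymmetry w r ∧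
             (modOr0 (j * blockLen m n + r) (m + n) ≡ᵇ modOr0 (i * blockLen m n) (m + n)))
      (upTo (m + n))

isOrbitRep : ℕ → ℕ → Word → ℕ → Bool
isOrbitRep m n w i = all (λ j → not (sameBlockOrbit m n w j i)) (upTo i)

distinguishableBlocks : ℕ → ℕ → Word → ℕ
distinguishableBlocks m n w = length (filter (λ i → isOrbitRep m n w i BP.≟ true) (upTo (gcd m n)))

-- binary necklaces of type (m,n), each represented by its minimal word s(ω)
necklaces : ℕ → ℕ → List Word
necklaces m n = filter (λ w → (hasType m n w ∧ isMinRep w) BP.≟ true) (allWords (m + n))

-- number of marked necklaces of type (m,n): pairs (necklace, distinguishable block)
markedNecklaceCount : ℕ → ℕ → ℕ
markedNecklaceCount m n = sum (map (distinguishableBlocks m n) (necklaces m n))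

-- Double counting.  Let N = m + n and g = gcd m n, and weight each pair (necklace ω, word x of
-- type (m,n)) by the number of distinguishable blocks of ω times the number of k < N for which
-- s(ω) rotated by k is x.  Summing over x, every necklace contributes N times its number of
-- distinguishable blocks, so the total is N times the number of marked necklaces.  Summing over
-- ω, only the necklace of x contributes.  If s(ω) has least period p and q = N / p, then x is
-- reached by exactly q rotations, and s(ω) is the q-th power of a word, so q divides n, m and
-- hence g.  Blocks have length L = N / g, so p = (g / q) L, and two blocks are identified exactly
-- when p divides their distance, which leaves g / q distinguishable blocks.  Every word therefore
-- contributes (g / q) q = g, and the total is g times the binomial coefficient.

module Submission where

open import Defs
open import Data.Nat using (ℕ; _+_; _*_; _<_)
open import Data.Nat.GCD using (gcd)
open import Data.Nat.Combinatorics using (_C_)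
open import Relation.Binary.PropositionalEquality using (_≡_)

open import Level using (0ℓ)
import Algebra.Properties.CommutativeSemigroup as CommSemigroupProperties
open import Data.Bool using (Bool; true; false; T; not; _∧_; if_then_else_)
open import Data.Bool.ListAction using (all; any)
open import Data.Bool.Properties using (T-∧; T-≡)
import Data.Bool.Properties as BP
open import Data.Empty using (⊥-elim)
open import Data.List
  using (List; []; _∷_; _++_; [_]; map; filter; length; concatMap; upTo;
         take; drop; concat; replicate)
open import Data.List.Properties
  using (≡-dec; map-upTo; map-applyUpTo; map-cong; map-++; ++-assoc; ++-identityʳ; ++-cancelˡ;
         length-++; length-take; length-drop; length-upTo; take++drop≡id; filter-++; ∷-injective)
open import Data.List.Relation.Unary.All using (All; []; _∷_)
import Data.List.Relation.Unary.All.Properties as All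
import Data.List.Relation.Unary.Any.Properties as Any
open import Data.Nat
  using (zero; suc; _∸_; _≤_; z≤n; s≤s; s≤s⁻¹; z<s; NonZero; pred; _≡ᵇ_;
         ≢-nonZero; ≢-nonZero⁻¹; >-nonZero; >-nonZero⁻¹)
open import Data.Nat.Combinatorics using (nCk+nC[k+1]≡[n+1]C[k+1])
open import Data.Nat.DivMod
  using (_%_; _/_; m%n<n; m/n*n≡m; m*[n/m]≡n; m≡m%n+[m/n]*n; m<n⇒m%n≡m; %-remove-+ˡ)
open import Data.Nat.Divisibility
  using (_∣_; divides; divides-refl; ∣m∣n⇒∣m+n; ∣m+n∣m⇒∣n; ∣⇒≤; ∣-refl; ∣-reflexive; m%n≡0⇒n∣m)
open import Data.Nat.GCD using (gcd[m,n]∣m; gcd[m,n]∣n; gcd[m,n]≢0; gcd-greatest)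
open import Data.Nat.GeneralisedArithmetic using (iterate)
open import Data.Nat.Induction using (<-rec)
open import Data.Nat.ListAction using (sum)
open import Data.Nat.ListAction.Properties using (sum-++)
open import Data.Nat.Properties
open import Data.Product using (∃-syntax; _×_; _,_; proj₁; proj₂)
open import Data.Sum using (_⊎_; inj₁; inj₂)
open import Function using (_∘_; _⇔_; mk⇔; Equivalence)
import Function.Properties.Equivalence as ⇔
open import Relation.Binary using (DecidableEquality; tri<; tri≈; tri>)
open import Relation.Binary.PropositionalEquality hiding ([_])
open import Relation.Nullary using (¬_; Dec; yes; no; does)
open import Relation.Nullary.Decidable using (T?; dec-true; dec-false; does-⇔; toWitness; fromWitness)
open import Relation.Unary using (Pred; Decidable)

-- Finite sums and indicators

private variable
  A B : Set
  P Q : Set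

𝟙 : Dec P → ℕ
𝟙 p? = if does p? then 1 else 0

𝟙-yes : (p? : Dec P) → P → 𝟙 p? ≡ 1
𝟙-yes p? p = cong (if_then 1 else 0) (dec-true p? p)

𝟙-no : (p? : Dec P) → ¬ P → 𝟙 p? ≡ 0
𝟙-no p? ¬p = cong (if_then 1 else 0) (dec-false p? ¬p)

𝟙-⇔ : P ⇔ Q → (p? : Dec P) (q? : Dec Q) → 𝟙 p? ≡ 𝟙 q?
𝟙-⇔ P⇔Q p? q? = cong (if_then 1 else 0) (does-⇔ P⇔Q p? q?)

𝟙-*-cong : ∀ (p? : Dec P) {a b} → (P → a ≡ b) → 𝟙 p? * a ≡ 𝟙 p? * b
𝟙-*-cong (yes p) a≡b = cong (1 *_) (a≡b p)
𝟙-*-cong (no _)  _   = refl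

∑ : List A → (A → ℕ) → ℕ
∑ xs f = sum (map f xs)

syntax ∑ xs (λ x → e) = ∑[ x ∈ xs ] e

∑-cong : ∀ (xs : List A) {f g : A → ℕ} → (∀ x → f x ≡ g x) → ∑ xs f ≡ ∑ xs g
∑-cong xs f≗g = cong sum (map-cong f≗g xs)

∑-congᴬ : ∀ {xs : List A} {f g : A → ℕ} → All (λ x → f x ≡ g x) xs → ∑ xs f ≡ ∑ xs g
∑-congᴬ []             = refl
∑-congᴬ (fx≡gx ∷ f≗g) = cong₂ _+_ fx≡gx (∑-congᴬ f≗g)

∑-upTo-cong : ∀ n {f g : ℕ → ℕ} → (∀ {k} → k < n → f k ≡ g k) → ∑ (upTo n) f ≡ ∑ (upTo n) g
∑-upTo-cong n f≗g = ∑-congᴬ (All.applyUpTo⁺₁ _ n f≗g)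

∑-+ : ∀ (xs : List A) (f g : A → ℕ) → ∑[ x ∈ xs ] (f x + g x) ≡ ∑ xs f + ∑ xs g
∑-+ []       f g = refl
∑-+ (x ∷ xs) f g = trans (cong (f x + g x +_) (∑-+ xs f g)) (interchange (f x) (g x) _ _)
  where open CommSemigroupProperties +-commutativeSemigroup using (interchange)

∑-*ˡ : ∀ (xs : List A) c (f : A → ℕ) → ∑[ x ∈ xs ] (c * f x) ≡ c * ∑ xs f
∑-*ˡ []       c f = sym (*-zeroʳ c)
∑-*ˡ (x ∷ xs) c f = trans (cong (c * f x +_) (∑-*ˡ xs c f)) (sym (*-distribˡ-+ c (f x) _))

∑-const : ∀ (xs : List A) c → ∑[ x ∈ xs ] c ≡ length xs * c
∑-const []       c = refl
∑-const (x ∷ xs) c = cong (c +_) (∑-const xs c)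

∑-swap : ∀ (xs : List A) (ys : List B) (f : A → B → ℕ) →
         ∑[ x ∈ xs ] ∑ ys (f x) ≡ ∑[ y ∈ ys ] ∑[ x ∈ xs ] f x y
∑-swap []       ys f = sym (trans (∑-const ys 0) (*-zeroʳ (length ys)))
∑-swap (x ∷ xs) ys f = trans (cong (∑ ys (f x) +_) (∑-swap xs ys f)) (sym (∑-+ ys (f x) _))

∑-filter : ∀ {P : Pred A _} (P? : Decidable P) (xs : List A) (f : A → ℕ) →
           ∑ (filter P? xs) f ≡ ∑[ x ∈ xs ] (𝟙 (P? x) * f x)
∑-filter P? []       f = refl
∑-filter P? (x ∷ xs) f with P? x
... | yes _ = cong₂ _+_ (sym (+-identityʳ (f x))) (∑-filter P? xs f)
... | no  _ = ∑-filter P? xs f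

length-filter≡∑ : ∀ {P : Pred A _} (P? : Decidable P) (xs : List A) →
                  length (filter P? xs) ≡ ∑ xs (𝟙 ∘ P?)
length-filter≡∑ P? []       = refl
length-filter≡∑ P? (x ∷ xs) with P? x
... | yes _ = cong suc (length-filter≡∑ P? xs)
... | no  _ = length-filter≡∑ P? xs

∑-concatMap : ∀ (h : A → List B) (xs : List A) (f : B → ℕ) →
              ∑ (concatMap h xs) f ≡ ∑[ x ∈ xs ] ∑ (h x) f
∑-concatMap h []       f = refl
∑-concatMap h (x ∷ xs) f = begin
  sum (map f (h x ++ concatMap h xs))           ≡⟨ cong sum (map-++ f (h x) _) ⟩
  sum (map f (h x) ++ map f (concatMap h xs))   ≡⟨ sum-++ (map f (h x)) _ ⟩
  ∑ (h x) f + ∑ (concatMap h xs) f              ≡⟨ cong (∑ (h x) f +_) (∑-concatMap h xs f) ⟩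
  ∑ (h x) f + ∑[ x ∈ xs ] ∑ (h x) f             ∎
  where open ≡-Reasoning

∑-upTo-suc : ∀ n (f : ℕ → ℕ) → ∑ (upTo (suc n)) f ≡ f 0 + ∑ (upTo n) (f ∘ suc)
∑-upTo-suc n f = cong (f 0 +_) (cong sum (trans (map-applyUpTo suc f n) (sym (map-upTo (f ∘ suc) n))))

∑-upTo-+ : ∀ a b (f : ℕ → ℕ) → ∑ (upTo (a + b)) f ≡ ∑ (upTo a) f + ∑[ k ∈ upTo b ] f (a + k)
∑-upTo-+ zero    b f = refl
∑-upTo-+ (suc a) b f = begin
  ∑ (upTo (suc a + b)) f
    ≡⟨ ∑-upTo-suc (a + b) f ⟩
  f 0 + ∑ (upTo (a + b)) (f ∘ suc)
    ≡⟨ cong (f 0 +_) (∑-upTo-+ a b (f ∘ suc)) ⟩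
  f 0 + (∑ (upTo a) (f ∘ suc) + ∑[ k ∈ upTo b ] f (suc a + k))
    ≡⟨ +-assoc (f 0) _ _ ⟨
  f 0 + ∑ (upTo a) (f ∘ suc) + ∑[ k ∈ upTo b ] f (suc a + k)
    ≡⟨ cong (_+ ∑[ k ∈ upTo b ] f (suc a + k)) (∑-upTo-suc a f) ⟨
  ∑ (upTo (suc a)) f + ∑[ k ∈ upTo b ] f (suc a + k) ∎
  where open ≡-Reasoning

∑-doubleCount : ∀ (xs : List A) (ys : List B) (M : A → B → ℕ) c d {f : A → ℕ} {h : B → ℕ} →
                (∀ x → ∑ ys (M x) ≡ c * f x) → (∀ y → ∑[ x ∈ xs ] M x y ≡ d * h y) →
                c * ∑ xs f ≡ d * ∑ ys h
∑-doubleCount xs ys M c d {f} {h} rows columns = begin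
  c * ∑ xs f                   ≡⟨ ∑-*ˡ xs c f ⟨
  ∑[ x ∈ xs ] (c * f x)        ≡⟨ ∑-cong xs rows ⟨
  ∑[ x ∈ xs ] ∑ ys (M x)       ≡⟨ ∑-swap xs ys M ⟩
  ∑[ y ∈ ys ] ∑[ x ∈ xs ] M x y ≡⟨ ∑-cong ys columns ⟩
  ∑[ y ∈ ys ] (d * h y)        ≡⟨ ∑-*ˡ ys d h ⟩
  d * ∑ ys h                   ∎
  where open ≡-Reasoning

∑-upTo-zero : ∀ n {f : ℕ → ℕ} → (∀ {k} → k < n → f k ≡ 0) → ∑ (upTo n) f ≡ 0
∑-upTo-zero n {f} f≗0 = begin
  ∑ (upTo n) f        ≡⟨ ∑-upTo-cong n f≗0 ⟩
  ∑[ k ∈ upTo n ] 0   ≡⟨ ∑-const (upTo n) 0 ⟩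
  length (upTo n) * 0 ≡⟨ *-zeroʳ (length (upTo n)) ⟩
  0                   ∎
  where open ≡-Reasoning

count-≡ : ∀ {n c} → c < n → ∑[ k ∈ upTo n ] 𝟙 (k ≟ c) ≡ 1
count-≡ {suc n} {zero}  _         = trans (∑-upTo-suc n (λ k → 𝟙 (k ≟ 0))) (cong suc (∑-upTo-zero n (λ _ → refl)))
count-≡ {suc n} {suc c} (s≤s c<n) = trans (∑-upTo-suc n (λ k → 𝟙 (k ≟ suc c))) (count-≡ c<n)

count-< : ∀ {g d} → d ≤ g → ∑[ i ∈ upTo g ] 𝟙 (i <? d) ≡ d
count-< {g}     {zero}  _         = ∑-upTo-zero g (λ _ → refl)
count-< {suc g} {suc d} (s≤s d≤g) = trans (∑-upTo-suc g (λ i → 𝟙 (i <? suc d))) (cong suc (count-< d≤g))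

count-% : ∀ p .{{_ : NonZero p}} q {c} → c < p → ∑[ k ∈ upTo (q * p) ] 𝟙 (k % p ≟ c) ≡ q
count-% p zero    c<p = refl
count-% p (suc q) {c} c<p = begin
  ∑[ k ∈ upTo (p + q * p) ] 𝟙 (k % p ≟ c)
    ≡⟨ ∑-upTo-+ p (q * p) _ ⟩
  ∑[ k ∈ upTo p ] 𝟙 (k % p ≟ c) + ∑[ k ∈ upTo (q * p) ] 𝟙 ((p + k) % p ≟ c)
    ≡⟨ cong₂ _+_ first rest ⟩
  1 + q ∎
  where
  open ≡-Reasoning
  first : ∑[ k ∈ upTo p ] 𝟙 (k % p ≟ c) ≡ 1
  first = trans (∑-upTo-cong p (λ k<p → cong (λ r → 𝟙 (r ≟ c)) (m<n⇒m%n≡m k<p))) (count-≡ c<p)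
  rest : ∑[ k ∈ upTo (q * p) ] 𝟙 ((p + k) % p ≟ c) ≡ q
  rest = trans (∑-cong (upTo (q * p)) (λ k → cong (λ r → 𝟙 (r ≟ c)) (%-remove-+ˡ k ∣-refl))) (count-% p q c<p)

-- Words, rotations and powers

T-all-upTo : ∀ (p : ℕ → Bool) n → T (all p (upTo n)) ⇔ (∀ {i} → i < n → T (p i))
T-all-upTo p n = mk⇔ (All.applyUpTo⁻ _ n ∘ All.all⁺ p (upTo n))
                     (All.all⁻ p ∘ All.applyUpTo⁺₁ _ n)

T-any-upTo : ∀ (p : ℕ → Bool) n → T (any p (upTo n)) ⇔ (∃[ i ] i < n × T (p i))
T-any-upTo p n = mk⇔ (Any.applyUpTo⁻ _ ∘ Any.any⁻ p (upTo n))
                     (λ (i , i<n , pi) → Any.any⁺ p (Any.applyUpTo⁺ _ pi i<n))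

T-not⇔¬T : ∀ {b} → T (not b) ⇔ (¬ T b)
T-not⇔¬T {false} = mk⇔ (λ _ ()) (λ _ → _)
T-not⇔¬T {true}  = mk⇔ (λ ()) (λ ¬T → ¬T _)

infix 4 _≟ʷ_

_≟ʷ_ : DecidableEquality Word
_≟ʷ_ = ≡-dec BP._≟_

hasType⇔ : ∀ m n w → T (hasType m n w) ⇔ (blacks w ≡ n × length w ≡ m + n)
hasType⇔ m n w = mk⇔
  (λ t → let b , l = Equivalence.to T-∧ t in ≡ᵇ⇒≡ _ _ b , ≡ᵇ⇒≡ _ _ l)
  (λ (b , l) → Equivalence.from T-∧ (≡⇒≡ᵇ _ _ b , ≡⇒≡ᵇ _ _ l))

∑-allWords-suc : ∀ N (f : Word → ℕ) →
                 ∑ (allWords (suc N)) f ≡ ∑[ w ∈ allWords N ] (f (false ∷ w) + f (true ∷ w))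
∑-allWords-suc N f = trans (∑-concatMap _ (allWords N) f)
                           (∑-cong (allWords N) (λ w → cong (f (false ∷ w) +_) (+-identityʳ _)))

∑-allWords-δ : ∀ N (F : Word → ℕ) {y} → length y ≡ N → ∑[ x ∈ allWords N ] (F x * 𝟙 (y ≟ʷ x)) ≡ F y
∑-allWords-δ zero    F {[]}    refl = trans (+-identityʳ _) (*-identityʳ (F []))
∑-allWords-δ (suc N) F {b ∷ y} refl = begin
  ∑[ x ∈ allWords (suc N) ] (F x * 𝟙 (b ∷ y ≟ʷ x))
    ≡⟨ ∑-allWords-suc N _ ⟩
  ∑[ w ∈ allWords N ] (F (false ∷ w) * 𝟙 (b ∷ y ≟ʷ false ∷ w) + F (true ∷ w) * 𝟙 (b ∷ y ≟ʷ true ∷ w))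
    ≡⟨ ∑-cong (allWords N) (first-bit b) ⟩
  ∑[ w ∈ allWords N ] (F (b ∷ w) * 𝟙 (y ≟ʷ w))
    ≡⟨ ∑-allWords-δ N (F ∘ (b ∷_)) refl ⟩
  F (b ∷ y) ∎
  where
  open ≡-Reasoning
  first-bit : ∀ b w → F (false ∷ w) * 𝟙 (b ∷ y ≟ʷ false ∷ w) + F (true ∷ w) * 𝟙 (b ∷ y ≟ʷ true ∷ w)
                      ≡ F (b ∷ w) * 𝟙 (y ≟ʷ w)
  first-bit false w = trans (cong (F (false ∷ w) * 𝟙 (y ≟ʷ w) +_) (*-zeroʳ (F (true ∷ w)))) (+-identityʳ _)
  first-bit true  w = cong (_+ F (true ∷ w) * 𝟙 (y ≟ʷ w)) (*-zeroʳ (F (false ∷ w)))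

∑-allWords-single : ∀ N {F : Word → ℕ} {y} → length y ≡ N → (∀ x → F x ≡ 0 ⊎ x ≡ y) →
                    ∑ (allWords N) F ≡ F y
∑-allWords-single N {F} {y} ∣y∣≡N supported =
  trans (∑-cong (allWords N) F≗F·δ) (∑-allWords-δ N F ∣y∣≡N)
  where
  F≗F·δ : ∀ x → F x ≡ F x * 𝟙 (y ≟ʷ x)
  F≗F·δ x with supported x | y ≟ʷ x
  ... | inj₁ Fx≡0 | _      = trans Fx≡0 (sym (cong (_* _) Fx≡0))
  ... | inj₂ _    | yes _  = sym (*-identityʳ (F x))
  ... | inj₂ refl | no x≢x = ⊥-elim (x≢x refl)

-- hasType m n is hasLengthBlacks (m + n) n; counting with the length as a separate parameter lets
-- the induction on the length go through.
hasLengthBlacks : ℕ → ℕ → Word → Bool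
hasLengthBlacks N k x = (blacks x ≡ᵇ k) ∧ (length x ≡ᵇ N)

count-hasLengthBlacks : ∀ N k → ∑[ x ∈ allWords N ] 𝟙 (T? (hasLengthBlacks N k x)) ≡ N C k
count-hasLengthBlacks zero    zero    = refl
count-hasLengthBlacks zero    (suc k) = refl
count-hasLengthBlacks (suc N) zero    = trans (∑-allWords-suc N _)
  (trans (∑-cong (allWords N) (λ w → +-identityʳ _)) (count-hasLengthBlacks N zero))
count-hasLengthBlacks (suc N) (suc k) = begin
  ∑[ x ∈ allWords (suc N) ] 𝟙 (T? (hasLengthBlacks (suc N) (suc k) x))
    ≡⟨ ∑-allWords-suc N _ ⟩
  ∑[ w ∈ allWords N ] (𝟙 (T? (hasLengthBlacks N (suc k) w)) + 𝟙 (T? (hasLengthBlacks N k w)))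
    ≡⟨ ∑-+ (allWords N) _ _ ⟩
  ∑[ w ∈ allWords N ] 𝟙 (T? (hasLengthBlacks N (suc k) w)) + ∑[ w ∈ allWords N ] 𝟙 (T? (hasLengthBlacks N k w))
    ≡⟨ cong₂ _+_ (count-hasLengthBlacks N (suc k)) (count-hasLengthBlacks N k) ⟩
  N C suc k + N C k
    ≡⟨ +-comm (N C suc k) (N C k) ⟩
  N C k + N C suc k
    ≡⟨ nCk+nC[k+1]≡[n+1]C[k+1] N k ⟩
  suc N C suc k ∎
  where open ≡-Reasoning

rotateOne : Word → Word
rotateOne []      = []
rotateOne (b ∷ w) = w ++ [ b ]

-- Unlike rotate, rot k is a rotation for every k, not only for k ≤ length w.
rot : ℕ → Word → Word
rot k w = iterate rotateOne w k

rot-+ : ∀ a b w → rot (a + b) w ≡ rot b (rot a w)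
rot-+ zero    b w = refl
rot-+ (suc a) b w = rot-+ a b (rotateOne w)

length-rotateOne : ∀ w → length (rotateOne w) ≡ length w
length-rotateOne []      = refl
length-rotateOne (b ∷ w) = trans (length-++ w) (+-comm (length w) 1)

length-rot : ∀ k w → length (rot k w) ≡ length w
length-rot zero    w = refl
length-rot (suc k) w = trans (length-rot k (rotateOne w)) (length-rotateOne w)

blacks-++ : ∀ u v → blacks (u ++ v) ≡ blacks u + blacks v
blacks-++ u v = trans (cong length (filter-++ _ u v)) (length-++ (filter _ u))

blacks-rotateOne : ∀ w → blacks (rotateOne w) ≡ blacks w
blacks-rotateOne []      = refl
blacks-rotateOne (b ∷ w) = trans (blacks-++ w [ b ]) (trans (+-comm (blacks w) _) (sym (blacks-++ [ b ] w)))

blacks-rot : ∀ k w → blacks (rot k w) ≡ blacks w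
blacks-rot zero    w = refl
blacks-rot (suc k) w = trans (blacks-rot k (rotateOne w)) (blacks-rotateOne w)

rot-length-++ : ∀ u v → rot (length u) (u ++ v) ≡ v ++ u
rot-length-++ []      v = sym (++-identityʳ v)
rot-length-++ (b ∷ u) v = begin
  rot (length u) ((u ++ v) ++ [ b ]) ≡⟨ cong (rot (length u)) (++-assoc u v [ b ]) ⟩
  rot (length u) (u ++ v ++ [ b ])   ≡⟨ rot-length-++ u (v ++ [ b ]) ⟩
  (v ++ [ b ]) ++ u                  ≡⟨ ++-assoc v [ b ] u ⟩
  v ++ b ∷ u                         ∎
  where open ≡-Reasoning

rotate≡rot : ∀ {k w} → k ≤ length w → rotate k w ≡ rot k w
rotate≡rot {k} {w} k≤∣w∣ = begin
  drop k w ++ take k w                          ≡⟨ rot-length-++ (take k w) (drop k w) ⟨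
  rot (length (take k w)) (take k w ++ drop k w) ≡⟨ cong₂ rot ∣take∣≡k (take++drop≡id k w) ⟩
  rot k w                                       ∎
  where
  open ≡-Reasoning
  ∣take∣≡k : length (take k w) ≡ k
  ∣take∣≡k = trans (length-take k w) (m≤n⇒m⊓n≡m k≤∣w∣)

rot-length : ∀ w → rot (length w) w ≡ w
rot-length w = trans (cong (rot (length w)) (sym (++-identityʳ w))) (rot-length-++ w [])

rot-multiple : ∀ {p w} → rot p w ≡ w → ∀ {r} → p ∣ r → rot r w ≡ w
rot-multiple {p} {w} rot-p (divides-refl t) = go t
  where
  go : ∀ t → rot (t * p) w ≡ w
  go zero    = refl
  go (suc t) = trans (rot-+ p (t * p) w) (trans (cong (rot (t * p)) rot-p) (go t))

rot-mod : ∀ {p w} .{{_ : NonZero p}} → rot p w ≡ w → ∀ k → rot k w ≡ rot (k % p) w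
rot-mod {p} {w} rot-p k = begin
  rot k w                         ≡⟨ cong (λ j → rot j w) (trans (m≡m%n+[m/n]*n k p) (+-comm (k % p) _)) ⟩
  rot (k / p * p + k % p) w       ≡⟨ rot-+ (k / p * p) (k % p) w ⟩
  rot (k % p) (rot (k / p * p) w) ≡⟨ cong (rot (k % p)) (rot-multiple rot-p (divides-refl (k / p))) ⟩
  rot (k % p) w                   ∎
  where open ≡-Reasoning

rot-inverse : ∀ k w .{{_ : NonZero (length w)}} → rot (pred (length w) * k) (rot k w) ≡ w
rot-inverse k w = begin
  rot (pred (length w) * k) (rot k w) ≡⟨ rot-+ k (pred (length w) * k) w ⟨
  rot (suc (pred (length w)) * k) w   ≡⟨ cong (λ N → rot (N * k) w) (suc-pred (length w)) ⟩
  rot (length w * k) w                ≡⟨ rot-multiple (rot-length w) (divides k (*-comm (length w) k)) ⟩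
  w                                   ∎
  where open ≡-Reasoning

hasType-rot : ∀ m n k w → hasType m n (rot k w) ≡ hasType m n w
hasType-rot m n k w = cong₂ (λ b l → (b ≡ᵇ n) ∧ (l ≡ᵇ m + n)) (blacks-rot k w) (length-rot k w)

++-prefix : ∀ (u v x y : List A) → u ++ v ≡ x ++ y → length u ≤ length x → ∃[ r ] x ≡ u ++ r
++-prefix []      v x       y _ _        = x , refl
++-prefix (a ∷ u) v (b ∷ x) y e (s≤s ∣u∣≤∣x∣) with ∷-injective e
... | refl , e′ = let r , x≡u++r = ++-prefix u v x y e′ ∣u∣≤∣x∣ in r , cong (a ∷_) x≡u++r

commuting-power : ∀ t (u v : List A) → length v ≡ t * length u → v ++ u ≡ u ++ v →
                  v ≡ concat (replicate t u)
commuting-power zero    u []      _   _    = refl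
commuting-power (suc t) u v       ∣v∣ comm with ++-prefix u v v u (sym comm) ∣u∣≤∣v∣
  where ∣u∣≤∣v∣ : length u ≤ length v
        ∣u∣≤∣v∣ = subst (length u ≤_) (sym ∣v∣) (m≤m+n (length u) (t * length u))
... | r , refl = cong (u ++_) (commuting-power t u r ∣r∣ r++u≡u++r)
  where
  ∣r∣ : length r ≡ t * length u
  ∣r∣ = +-cancelˡ-≡ (length u) _ _ (trans (sym (length-++ u)) ∣v∣)
  r++u≡u++r : r ++ u ≡ u ++ r
  r++u≡u++r = ++-cancelˡ u (r ++ u) (u ++ r) (trans (sym (++-assoc u r u)) comm)

blacks-power : ∀ t u → blacks (concat (replicate t u)) ≡ t * blacks u
blacks-power zero    u = refl
blacks-power (suc t) u = trans (blacks-++ u _) (cong (blacks u +_) (blacks-power t u))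

rot-period-power : ∀ {p w} q → rot p w ≡ w → length w ≡ q * p → w ≡ concat (replicate q (take p w))
rot-period-power {p} {[]}    zero    _     _   = refl
rot-period-power {p} {w}     (suc t) rot-p ∣w∣ =
  trans (sym (take++drop≡id p w)) (cong (take p w ++_) (commuting-power t (take p w) (drop p w) ∣drop∣ comm))
  where
  p≤∣w∣ : p ≤ length w
  p≤∣w∣ = subst (p ≤_) (sym ∣w∣) (m≤m+n p (t * p))
  ∣drop∣ : length (drop p w) ≡ t * length (take p w)
  ∣drop∣ = begin
    length (drop p w)     ≡⟨ length-drop p w ⟩
    length w ∸ p          ≡⟨ cong (_∸ p) ∣w∣ ⟩
    p + t * p ∸ p         ≡⟨ m+n∸m≡n p (t * p) ⟩
    t * p                 ≡⟨ cong (t *_) (trans (length-take p w) (m≤n⇒m⊓n≡m p≤∣w∣)) ⟨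
    t * length (take p w) ∎
    where open ≡-Reasoning
  comm : drop p w ++ take p w ≡ take p w ++ drop p w
  comm = trans (rotate≡rot p≤∣w∣) (trans rot-p (sym (take++drop≡id p w)))

-- Minimal rotations

lexLeq-refl : ∀ u → T (lexLeq u u)
lexLeq-refl []          = _
lexLeq-refl (false ∷ u) = lexLeq-refl u
lexLeq-refl (true ∷ u)  = lexLeq-refl u

lexLeq-trans : ∀ u v w → T (lexLeq u v) → T (lexLeq v w) → T (lexLeq u w)
lexLeq-trans []          _           _           _   _   = _
lexLeq-trans (false ∷ u) (false ∷ v) (false ∷ w) u≤v v≤w = lexLeq-trans u v w u≤v v≤w
lexLeq-trans (false ∷ u) (false ∷ v) (true ∷ w)  _   _   = _
lexLeq-trans (false ∷ u) (true ∷ v)  (true ∷ w)  _   _   = _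
lexLeq-trans (true ∷ u)  (true ∷ v)  (true ∷ w)  u≤v v≤w = lexLeq-trans u v w u≤v v≤w

lexLeq-total : ∀ u v → ¬ T (lexLeq u v) → T (lexLeq v u)
lexLeq-total []          v           u≰v = ⊥-elim (u≰v _)
lexLeq-total (_ ∷ _)     []          _   = _
lexLeq-total (false ∷ u) (false ∷ v) u≰v = lexLeq-total u v u≰v
lexLeq-total (false ∷ u) (true ∷ v)  u≰v = ⊥-elim (u≰v _)
lexLeq-total (true ∷ u)  (false ∷ v) _   = _
lexLeq-total (true ∷ u)  (true ∷ v)  u≰v = lexLeq-total u v u≰v

lexLeq-antisym : ∀ u v → T (lexLeq u v) → T (lexLeq v u) → u ≡ v
lexLeq-antisym []          []          _   _   = refl
lexLeq-antisym (false ∷ u) (false ∷ v) u≤v v≤u = cong (false ∷_) (lexLeq-antisym u v u≤v v≤u)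
lexLeq-antisym (true ∷ u)  (true ∷ v)  u≤v v≤u = cong (true ∷_) (lexLeq-antisym u v u≤v v≤u)

≤-suc-elim : ∀ {P : ℕ → Set} {n} → (∀ {a} → a ≤ n → P a) → P (suc n) → ∀ {a} → a ≤ suc n → P a
≤-suc-elim below top a≤1+n with m≤n⇒m<n∨m≡n a≤1+n
... | inj₁ a<1+n = below (s≤s⁻¹ a<1+n)
... | inj₂ refl  = top

lexArgmin : ∀ (f : ℕ → Word) n → ∃[ k ] (∀ {a} → a ≤ n → T (lexLeq (f k) (f a)))
lexArgmin f zero = 0 , λ { z≤n → lexLeq-refl (f 0) }
lexArgmin f (suc n) with lexArgmin f n
... | k , k-least with T? (lexLeq (f k) (f (suc n)))
...   | yes fk≤ = k , ≤-suc-elim {P = T ∘ lexLeq (f k) ∘ f} k-least fk≤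
...   | no  fk≰ = suc n , ≤-suc-elim {P = T ∘ lexLeq (f (suc n)) ∘ f}
                    (λ a≤n → lexLeq-trans (f (suc n)) (f k) _ (lexLeq-total (f k) _ fk≰) (k-least a≤n))
                    (lexLeq-refl (f (suc n)))

isMinRep⇔ : ∀ u → T (isMinRep u) ⇔ (∀ {k} → k < length u → T (lexLeq u (rot k u)))
isMinRep⇔ u = mk⇔
  (λ min {k} k<∣u∣ → subst (T ∘ lexLeq u) (rotate≡rot (<⇒≤ k<∣u∣)) (Equivalence.to all⇔ min k<∣u∣))
  (λ ≤rot → Equivalence.from all⇔ (λ k<∣u∣ → subst (T ∘ lexLeq u) (sym (rotate≡rot (<⇒≤ k<∣u∣))) (≤rot k<∣u∣)))
  where
  all⇔ : T (isMinRep u) ⇔ (∀ {k} → k < length u → T (lexLeq u (rotate k u)))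
  all⇔ = T-all-upTo (λ k → lexLeq u (rotate k u)) (length u)

rot-nonZero : ∀ a u .{{_ : NonZero (length u)}} → NonZero (length (rot a u))
rot-nonZero a u = ≢-nonZero (≢-nonZero⁻¹ (length u) ∘ trans (sym (length-rot a u)))

isMinRep-≤rot : ∀ u .{{_ : NonZero (length u)}} → T (isMinRep u) → ∀ a → T (lexLeq u (rot a u))
isMinRep-≤rot u min a =
  subst (T ∘ lexLeq u) (sym (rot-mod (rot-length u) a)) (Equivalence.to (isMinRep⇔ u) min (m%n<n a (length u)))

isMinRep-unique : ∀ {u} .{{_ : NonZero (length u)}} a → T (isMinRep u) → T (isMinRep (rot a u)) → rot a u ≡ u
isMinRep-unique {u} a min-u min-rot =
  lexLeq-antisym (rot a u) u rot≤u (isMinRep-≤rot u min-u a)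
  where
  instance
    rot≢0 : NonZero (length (rot a u))
    rot≢0 = rot-nonZero a u
  rot≤u : T (lexLeq (rot a u) u)
  rot≤u = subst (T ∘ lexLeq (rot a u)) (rot-inverse a u) (isMinRep-≤rot (rot a u) min-rot (pred (length u) * a))

minimalRotation : ∀ x .{{_ : NonZero (length x)}} → ∃[ k ] T (isMinRep (rot k x))
minimalRotation x with lexArgmin (λ a → rot a x) (pred (length x))
... | k , k-least = k , Equivalence.from (isMinRep⇔ (rot k x)) ≤rot
  where
  ≤rot : ∀ {j} → j < length (rot k x) → T (lexLeq (rot k x) (rot j (rot k x)))
  ≤rot {j} _ = subst (T ∘ lexLeq (rot k x)) (trans (sym (rot-mod (rot-length x) (k + j))) (rot-+ k j x))
                     (k-least (<⇒≤pred (m%n<n (k + j) (length x))))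

-- The least period

leastWitness : ∀ {P : Pred ℕ 0ℓ} → Decidable P → ∀ {n} → P n → ∃[ k ] P k × (∀ {j} → j < k → ¬ P j)
leastWitness {P} P? {n} = <-rec (λ n → P n → ∃[ k ] P k × (∀ {j} → j < k → ¬ P j)) search n
  where
  search : ∀ n → (∀ {j} → j < n → P j → ∃[ k ] P k × (∀ {i} → i < k → ¬ P i)) →
           P n → ∃[ k ] P k × (∀ {j} → j < k → ¬ P j)
  search n below Pn with anyUpTo? P? n
  ... | yes (j , j<n , Pj) = below j<n Pj
  ... | no  ∄j             = n , Pn , λ j<n Pj → ∄j (_ , j<n , Pj)

record LeastPeriod (w : Word) : Set where
  field
    period               : ℕ
    {{period-nonZero}}   : NonZero period
    rot-period           : rot period w ≡ w
    period-least         : ∀ {s} → 0 < s → s < period → rot s w ≢ w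

leastPeriod : ∀ w .{{_ : NonZero (length w)}} → LeastPeriod w
leastPeriod w with leastWitness (λ s → rot (suc s) w ≟ʷ w) {pred (length w)} rot-N
  where rot-N : rot (suc (pred (length w))) w ≡ w
        rot-N = trans (cong (λ N → rot N w) (suc-pred (length w))) (rot-length w)
... | k , rot-1+k , below = record
  { period       = suc k
  ; rot-period   = rot-1+k
  ; period-least = λ { {suc s} _ (s≤s s<k) → below s<k }
  }

rotationCount : Word → Word → ℕ
rotationCount w x = ∑[ k ∈ upTo (length w) ] 𝟙 (rot k w ≟ʷ x)

∑-allWords-rotationCount : ∀ N (F : Word → ℕ) w → length w ≡ N →
  ∑[ x ∈ allWords N ] (F x * rotationCount w x) ≡ ∑[ k ∈ upTo (length w) ] F (rot k w)
∑-allWords-rotationCount N F w ∣w∣≡N = begin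
  ∑[ x ∈ allWords N ] (F x * ∑[ k ∈ upTo (length w) ] 𝟙 (rot k w ≟ʷ x))
    ≡⟨ ∑-cong (allWords N) (λ x → ∑-*ˡ (upTo (length w)) (F x) _) ⟨
  ∑[ x ∈ allWords N ] ∑[ k ∈ upTo (length w) ] (F x * 𝟙 (rot k w ≟ʷ x))
    ≡⟨ ∑-swap (allWords N) (upTo (length w)) _ ⟩
  ∑[ k ∈ upTo (length w) ] ∑[ x ∈ allWords N ] (F x * 𝟙 (rot k w ≟ʷ x))
    ≡⟨ ∑-cong (upTo (length w)) (λ k → ∑-allWords-δ N F (trans (length-rot k w) ∣w∣≡N)) ⟩
  ∑[ k ∈ upTo (length w) ] F (rot k w) ∎
  where open ≡-Reasoning

module LeastPeriodProperties {w : Word} (lp : LeastPeriod w) where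
  open LeastPeriod lp

  rot≡⇒period∣ : ∀ {r} → rot r w ≡ w → period ∣ r
  rot≡⇒period∣ {r} rot-r with r % period in r%p≡
  ... | zero  = m%n≡0⇒n∣m r period r%p≡
  ... | suc s = ⊥-elim (period-least z<s (subst (_< period) r%p≡ (m%n<n r period))
                  (trans (cong (λ j → rot j w) (sym r%p≡)) (trans (sym (rot-mod rot-period r)) rot-r)))

  period∣length : period ∣ length w
  period∣length = rot≡⇒period∣ (rot-length w)

  rot-injective-< : ∀ {a b} → a < b → b < period → rot a w ≢ rot b w
  rot-injective-< {a} {b} a<b b<p rot-a≡rot-b = period-least 0<s s<p rot-s
    where
    s : ℕ
    s = a + (period ∸ b)
    0<s : 0 < s
    0<s = ≤-trans (m<n⇒0<n∸m b<p) (m≤n+m (period ∸ b) a)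
    s<p : s < period
    s<p = begin-strict
      a + (period ∸ b) <⟨ +-monoˡ-< (period ∸ b) a<b ⟩
      b + (period ∸ b) ≡⟨ m+[n∸m]≡n (<⇒≤ b<p) ⟩
      period           ∎
      where open ≤-Reasoning
    rot-s : rot s w ≡ w
    rot-s = begin
      rot (a + (period ∸ b)) w    ≡⟨ rot-+ a (period ∸ b) w ⟩
      rot (period ∸ b) (rot a w)  ≡⟨ cong (rot (period ∸ b)) rot-a≡rot-b ⟩
      rot (period ∸ b) (rot b w)  ≡⟨ rot-+ b (period ∸ b) w ⟨
      rot (b + (period ∸ b)) w    ≡⟨ cong (λ j → rot j w) (m+[n∸m]≡n (<⇒≤ b<p)) ⟩
      rot period w                ≡⟨ rot-period ⟩
      w                           ∎
      where open ≡-Reasoning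

  rot≡rot⇔%≡% : ∀ k j → rot k w ≡ rot j w ⇔ k % period ≡ j % period
  rot≡rot⇔%≡% k j = mk⇔ to from
    where
    from : k % period ≡ j % period → rot k w ≡ rot j w
    from eq = trans (rot-mod rot-period k) (trans (cong (λ i → rot i w) eq) (sym (rot-mod rot-period j)))
    to : rot k w ≡ rot j w → k % period ≡ j % period
    to eq with <-cmp (k % period) (j % period)
    ... | tri< lt _ _ = ⊥-elim (rot-injective-< lt (m%n<n j period) eq′)
      where eq′ : rot (k % period) w ≡ rot (j % period) w
            eq′ = trans (sym (rot-mod rot-period k)) (trans eq (rot-mod rot-period j))
    ... | tri≈ _ e _  = e
    ... | tri> _ _ gt = ⊥-elim (rot-injective-< gt (m%n<n k period) eq′)
      where eq′ : rot (j % period) w ≡ rot (k % period) w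
            eq′ = trans (sym (rot-mod rot-period j)) (trans (sym eq) (rot-mod rot-period k))

  order : ℕ
  order = length w / period

  length≡order*period : length w ≡ order * period
  length≡order*period = sym (m/n*n≡m period∣length)

  rotationCount-rot : ∀ j → rotationCount w (rot j w) ≡ order
  rotationCount-rot j = begin
    ∑[ k ∈ upTo (length w) ] 𝟙 (rot k w ≟ʷ rot j w)
      ≡⟨ ∑-cong (upTo (length w)) (λ k → 𝟙-⇔ (rot≡rot⇔%≡% k j) (rot k w ≟ʷ rot j w) (k % period ≟ j % period)) ⟩
    ∑[ k ∈ upTo (length w) ] 𝟙 (k % period ≟ j % period)
      ≡⟨ cong (λ N → ∑[ k ∈ upTo N ] 𝟙 (k % period ≟ j % period)) length≡order*period ⟩
    ∑[ k ∈ upTo (order * period) ] 𝟙 (k % period ≟ j % period)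
      ≡⟨ count-% period order (m%n<n j period) ⟩
    order ∎
    where open ≡-Reasoning

  blacks-period : blacks w ≡ order * blacks (take period w)
  blacks-period = trans (cong blacks (rot-period-power order rot-period length≡order*period))
                        (blacks-power order (take period w))

-- Marked necklaces of type (m,n)

divOr0≡/ : ∀ a d .{{_ : NonZero d}} → divOr0 a d ≡ a / d
divOr0≡/ a (suc d) = refl

modOr0≡% : ∀ a d .{{_ : NonZero d}} → modOr0 a d ≡ a % d
modOr0≡% a (suc d) = refl

+-%-no-wrap : ∀ {a r N} .{{_ : NonZero N}} → r < N → a ≤ (a + r) % N → a + r ≡ (a + r) % N
+-%-no-wrap {a} {r} {N} r<N a≤ with (a + r) / N | m≡m%n+[m/n]*n (a + r) N
... | zero  | a+r≡ = trans a+r≡ (+-identityʳ _)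
... | suc t | a+r≡ = ⊥-elim (<-irrefl refl (begin-strict
  a + r                      <⟨ +-monoʳ-< a r<N ⟩
  a + N                      ≤⟨ +-monoˡ-≤ N a≤ ⟩
  (a + r) % N + N            ≤⟨ +-monoʳ-≤ ((a + r) % N) (m≤m+n N (t * N)) ⟩
  (a + r) % N + suc t * N    ≡⟨ a+r≡ ⟨
  a + r                      ∎))
  where open ≤-Reasoning

module Necklaces (m n : ℕ) {{m≢0 : NonZero m}} where

  N g L : ℕ
  N = m + n
  g = gcd m n
  L = blockLen m n

  instance
    N≢0 : NonZero N
    N≢0 = >-nonZero (≤-trans (>-nonZero⁻¹ m) (m≤m+n m n))

    g≢0 : NonZero g
    g≢0 = ≢-nonZero (gcd[m,n]≢0 m n (inj₁ (≢-nonZero⁻¹ m)))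

  N≡g*L : N ≡ g * L
  N≡g*L = sym (trans (cong (g *_) (divOr0≡/ N g)) (m*[n/m]≡n (∣m∣n⇒∣m+n (gcd[m,n]∣m m n) (gcd[m,n]∣n m n))))

  instance
    L≢0 : NonZero L
    L≢0 = ≢-nonZero λ L≡0 → ≢-nonZero⁻¹ N (trans N≡g*L (trans (cong (g *_) L≡0) (*-zeroʳ g)))

  iL<N : ∀ {i} → i < g → i * L < N
  iL<N {i} i<g = subst (i * L <_) (sym N≡g*L) (*-monoˡ-< L i<g)

  module Blocks {w : Word} (∣w∣≡N : length w ≡ N) (lp : LeastPeriod w)
                (d : ℕ) (period≡d*L : LeastPeriod.period lp ≡ d * L) where
    open LeastPeriod lp
    open LeastPeriodProperties lp

    isSymmetry⇔ : ∀ {r} → r ≤ N → T (isSymmetry w r) ⇔ period ∣ r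
    isSymmetry⇔ {r} r≤N = mk⇔
      (λ sym-r → rot≡⇒period∣ (trans (sym (rotate≡rot r≤∣w∣)) (toWitness sym-r)))
      (λ p∣r → fromWitness (trans (rotate≡rot r≤∣w∣) (rot-multiple rot-period p∣r)))
      where r≤∣w∣ : r ≤ length w
            r≤∣w∣ = subst (r ≤_) (sym ∣w∣≡N) r≤N

    sameBlockOrbit⇔ : ∀ {j i} → j < i → i < g → T (sameBlockOrbit m n w j i) ⇔ period ∣ (i ∸ j) * L
    sameBlockOrbit⇔ {j} {i} j<i i<g = mk⇔ to from
      where
      any⇔ : T (sameBlockOrbit m n w j i) ⇔ (∃[ r ] r < N × T (isSymmetry w r ∧ (modOr0 (j * L + r) N ≡ᵇ modOr0 (i * L) N)))
      any⇔ = T-any-upTo (λ r → isSymmetry w r ∧ (modOr0 (j * L + r) N ≡ᵇ modOr0 (i * L) N)) N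
      iL%N≡iL : modOr0 (i * L) N ≡ i * L
      iL%N≡iL = trans (modOr0≡% (i * L) N) (m<n⇒m%n≡m (iL<N i<g))
      jL+[i∸j]L≡iL : j * L + (i ∸ j) * L ≡ i * L
      jL+[i∸j]L≡iL = trans (sym (*-distribʳ-+ L j (i ∸ j))) (cong (_* L) (m+[n∸m]≡n (<⇒≤ j<i)))

      to : T (sameBlockOrbit m n w j i) → period ∣ (i ∸ j) * L
      to same with Equivalence.to any⇔ same
      ... | r , r<N , sym∧shift with Equivalence.to T-∧ sym∧shift
      ...   | sym-r , shift = subst (period ∣_) r≡[i∸j]L (Equivalence.to (isSymmetry⇔ (<⇒≤ r<N)) sym-r)
        where
        [jL+r]%N≡iL : (j * L + r) % N ≡ i * L
        [jL+r]%N≡iL = trans (sym (modOr0≡% _ N)) (trans (≡ᵇ⇒≡ _ _ shift) iL%N≡iL)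
        jL+r≡iL : j * L + r ≡ i * L
        jL+r≡iL = trans (+-%-no-wrap r<N (subst (j * L ≤_) (sym [jL+r]%N≡iL) (*-monoˡ-≤ L (<⇒≤ j<i))))
                        [jL+r]%N≡iL
        r≡[i∸j]L : r ≡ (i ∸ j) * L
        r≡[i∸j]L = +-cancelˡ-≡ (j * L) _ _ (trans jL+r≡iL (sym jL+[i∸j]L≡iL))

      from : period ∣ (i ∸ j) * L → T (sameBlockOrbit m n w j i)
      from p∣ = Equivalence.from any⇔ (_ , r<N , Equivalence.from T-∧ (sym-r , shift))
        where
        r<N : (i ∸ j) * L < N
        r<N = iL<N (≤-<-trans (m∸n≤m i j) i<g)
        sym-r : T (isSymmetry w ((i ∸ j) * L))
        sym-r = Equivalence.from (isSymmetry⇔ (<⇒≤ r<N)) p∣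
        shift : T (modOr0 (j * L + (i ∸ j) * L) N ≡ᵇ modOr0 (i * L) N)
        shift = ≡⇒≡ᵇ _ _ (cong (λ a → modOr0 a N) jL+[i∸j]L≡iL)

    instance
      d≢0 : NonZero d
      d≢0 = m*n≢0⇒m≢0 d {{subst NonZero period≡d*L period-nonZero}}

    isOrbitRep⇔ : ∀ {i} → i < g → T (isOrbitRep m n w i) ⇔ i < d
    isOrbitRep⇔ {i} i<g = mk⇔ to from
      where
      all⇔ : T (isOrbitRep m n w i) ⇔ (∀ {j} → j < i → T (not (sameBlockOrbit m n w j i)))
      all⇔ = T-all-upTo (λ j → not (sameBlockOrbit m n w j i)) i
      separated : ∀ {j} → j < i → T (not (sameBlockOrbit m n w j i)) ⇔ (¬ period ∣ (i ∸ j) * L)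
      separated j<i = ⇔.trans T-not⇔¬T (mk⇔ (λ ¬same p∣ → ¬same (from-∣ p∣)) (λ ¬p∣ same → ¬p∣ (to-∣ same)))
        where open Equivalence (sameBlockOrbit⇔ j<i i<g) renaming (to to to-∣; from to from-∣)

      to : T (isOrbitRep m n w i) → i < d
      to rep with i <? d
      ... | yes i<d = i<d
      ... | no  i≮d = ⊥-elim (Equivalence.to (separated j<i) (Equivalence.to all⇔ rep j<i) p∣[i∸j]L)
        where
        d≤i : d ≤ i
        d≤i = ≮⇒≥ i≮d
        j<i : i ∸ d < i
        j<i = ∸-monoʳ-< (>-nonZero⁻¹ d) d≤i
        p∣[i∸j]L : period ∣ (i ∸ (i ∸ d)) * L
        p∣[i∸j]L = subst (λ k → period ∣ k * L) (sym (m∸[m∸n]≡n d≤i)) (∣-reflexive period≡d*L)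

      from : i < d → T (isOrbitRep m n w i)
      from i<d = Equivalence.from all⇔ (λ j<i → Equivalence.from (separated j<i) (¬p∣ j<i))
        where
        ¬p∣ : ∀ {j} → j < i → ¬ period ∣ (i ∸ j) * L
        ¬p∣ {j} j<i p∣ = <⇒≱ [i∸j]L<p (∣⇒≤ {{m*n≢0 (i ∸ j) L {{>-nonZero (m<n⇒0<n∸m j<i)}}}} p∣)
          where
          [i∸j]L<p : (i ∸ j) * L < period
          [i∸j]L<p = subst ((i ∸ j) * L <_) (sym period≡d*L) (*-monoˡ-< L (≤-<-trans (m∸n≤m i j) i<d))

    distinguishableBlocks≡ : distinguishableBlocks m n w ≡ d
    distinguishableBlocks≡ = begin
      length (filter (λ i → isOrbitRep m n w i BP.≟ true) (upTo g))
        ≡⟨ length-filter≡∑ (λ i → isOrbitRep m n w i BP.≟ true) (upTo g) ⟩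
      ∑[ i ∈ upTo g ] 𝟙 (isOrbitRep m n w i BP.≟ true)
        ≡⟨ ∑-upTo-cong g (λ {i} i<g → 𝟙-⇔ (⇔.trans (⇔.sym T-≡) (isOrbitRep⇔ i<g)) (isOrbitRep m n w i BP.≟ true) (i <? d)) ⟩
      ∑[ i ∈ upTo g ] 𝟙 (i <? d)
        ≡⟨ count-< d≤g ⟩
      d ∎
      where
      open ≡-Reasoning
      d≤g : d ≤ g
      d≤g = *-cancelʳ-≤ d g L (subst₂ _≤_ period≡d*L N≡g*L (∣⇒≤ (subst (period ∣_) ∣w∣≡N period∣length)))

  module OfType {w : Word} (w-type : T (hasType m n w)) where
    blacks≡n : blacks w ≡ n
    blacks≡n = proj₁ (Equivalence.to (hasType⇔ m n w) w-type)

    ∣w∣≡N : length w ≡ N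
    ∣w∣≡N = proj₂ (Equivalence.to (hasType⇔ m n w) w-type)

    instance
      ∣w∣≢0 : NonZero (length w)
      ∣w∣≢0 = subst NonZero (sym ∣w∣≡N) N≢0

    lp : LeastPeriod w
    lp = leastPeriod w
    open LeastPeriod lp
    open LeastPeriodProperties lp

    order∣n : order ∣ n
    order∣n = divides (blacks (take period w)) (trans (sym blacks≡n) (trans blacks-period (*-comm order _)))

    order∣N : order ∣ N
    order∣N = divides period (trans (sym ∣w∣≡N) (trans length≡order*period (*-comm order period)))

    order∣g : order ∣ g
    order∣g = gcd-greatest (∣m+n∣m⇒∣n (subst (order ∣_) (+-comm m n) order∣N) order∣n) order∣n

    instance
      order≢0 : NonZero order
      order≢0 = ≢-nonZero λ order≡0 → ≢-nonZero⁻¹ (length w) (trans length≡order*period (cong (_* period) order≡0))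

    d : ℕ
    d = g / order

    g≡d*order : g ≡ d * order
    g≡d*order = sym (m/n*n≡m order∣g)

    period≡d*L : period ≡ d * L
    period≡d*L = *-cancelˡ-≡ period (d * L) order (begin
      order * period  ≡⟨ length≡order*period ⟨
      length w        ≡⟨ trans ∣w∣≡N N≡g*L ⟩
      g * L           ≡⟨ cong (_* L) (trans g≡d*order (*-comm d order)) ⟩
      order * d * L   ≡⟨ *-assoc order d L ⟩
      order * (d * L) ∎)
      where open ≡-Reasoning

    open Blocks ∣w∣≡N lp d period≡d*L using (distinguishableBlocks≡)

    blocks*rotationCount : ∀ j → distinguishableBlocks m n w * rotationCount w (rot j w) ≡ g
    blocks*rotationCount j = trans (cong₂ _*_ distinguishableBlocks≡ (rotationCount-rot j)) (sym g≡d*order)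

  necklace? : (w : Word) → Dec ((hasType m n w ∧ isMinRep w) ≡ true)
  necklace? w = (hasType m n w ∧ isMinRep w) BP.≟ true

  necklace⇔ : ∀ w → ((hasType m n w ∧ isMinRep w) ≡ true) ⇔ (T (hasType m n w) × T (isMinRep w))
  necklace⇔ w = ⇔.trans (⇔.sym T-≡) T-∧

  hasType? : (x : Word) → Dec (T (hasType m n x))
  hasType? x = T? (hasType m n x)

  ∑-hasType-rotationCount : ∀ {w} → T (hasType m n w) → ∑[ x ∈ allWords N ] (𝟙 (hasType? x) * rotationCount w x) ≡ N
  ∑-hasType-rotationCount {w} w-type = begin
    ∑[ x ∈ allWords N ] (𝟙 (hasType? x) * rotationCount w x) ≡⟨ ∑-allWords-rotationCount N (𝟙 ∘ hasType?) w ∣w∣≡N ⟩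
    ∑[ k ∈ upTo (length w) ] 𝟙 (hasType? (rot k w))          ≡⟨ ∑-cong (upTo (length w)) rot-type ⟩
    ∑[ k ∈ upTo (length w) ] 1                                ≡⟨ ∑-const (upTo (length w)) 1 ⟩
    length (upTo (length w)) * 1                              ≡⟨ trans (*-identityʳ _) (length-upTo (length w)) ⟩
    length w                                                  ≡⟨ ∣w∣≡N ⟩
    N                                                         ∎
    where
    open ≡-Reasoning
    open OfType {w} w-type using (∣w∣≡N)
    rot-type : ∀ k → 𝟙 (hasType? (rot k w)) ≡ 1
    rot-type k = 𝟙-yes (hasType? (rot k w)) (subst T (sym (hasType-rot m n k w)) w-type)

  necklaceWeight : Word → Word → ℕ
  necklaceWeight x w = 𝟙 (necklace? w) * (distinguishableBlocks m n w * rotationCount w x)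

  necklaceWeight-minimalRotation : ∀ {x} k → T (hasType m n x) → T (isMinRep (rot k x)) →
                                   necklaceWeight x (rot k x) ≡ g
  necklaceWeight-minimalRotation {x} k x-type w₀-min = begin
    𝟙 (necklace? w₀) * (D w₀ * rotationCount w₀ x)
      ≡⟨ cong (_* (D w₀ * rotationCount w₀ x)) is-necklace ⟩
    1 * (D w₀ * rotationCount w₀ x)
      ≡⟨ *-identityˡ _ ⟩
    D w₀ * rotationCount w₀ x
      ≡⟨ cong (λ y → D w₀ * rotationCount w₀ y) (rot-inverse k x) ⟨
    D w₀ * rotationCount w₀ (rot (pred (length x) * k) w₀)
      ≡⟨ OfType.blocks*rotationCount {w₀} w₀-type (pred (length x) * k) ⟩
    g ∎
    where
    open ≡-Reasoning
    open OfType {x} x-type using () renaming (∣w∣≢0 to ∣x∣≢0)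
    D : Word → ℕ
    D = distinguishableBlocks m n
    w₀ : Word
    w₀ = rot k x
    w₀-type : T (hasType m n w₀)
    w₀-type = subst T (sym (hasType-rot m n k x)) x-type
    is-necklace : 𝟙 (necklace? w₀) ≡ 1
    is-necklace = 𝟙-yes (necklace? w₀) (Equivalence.from (necklace⇔ w₀) (w₀-type , w₀-min))

  necklaceWeight-supported : ∀ {x} k → T (hasType m n x) → T (isMinRep (rot k x)) →
                             ∀ w → necklaceWeight x w ≡ 0 ⊎ w ≡ rot k x
  necklaceWeight-supported {x} k x-type w₀-min w with necklace? w
  ... | no _ = inj₁ refl
  ... | yes is-necklace with Equivalence.to (necklace⇔ w) is-necklace
  ...   | w-type , w-min with anyUpTo? (λ j → rot j w ≟ʷ x) (length w)
  ...     | no ∄j = inj₁ (trans (cong (λ e → 1 * (distinguishableBlocks m n w * e)) count≡0)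
                                (cong (1 *_) (*-zeroʳ (distinguishableBlocks m n w))))
    where
    count≡0 : rotationCount w x ≡ 0
    count≡0 = ∑-upTo-zero (length w) (λ {j} j< → 𝟙-no (rot j w ≟ʷ x) (λ rot-j≡x → ∄j (j , j< , rot-j≡x)))
  ...     | yes (j , _ , rot-j≡x) = inj₂ (trans (sym (isMinRep-unique (j + k) w-min min′)) rot-j+k≡)
    where
    open OfType {w} w-type using (∣w∣≢0)
    rot-j+k≡ : rot (j + k) w ≡ rot k x
    rot-j+k≡ = trans (rot-+ j k w) (cong (rot k) rot-j≡x)
    min′ : T (isMinRep (rot (j + k) w))
    min′ = subst (T ∘ isMinRep) (sym rot-j+k≡) w₀-min

  ∑-necklaceWeight : ∀ {x} → T (hasType m n x) → ∑ (allWords N) (necklaceWeight x) ≡ g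
  ∑-necklaceWeight {x} x-type =
    trans (∑-allWords-single N (trans (length-rot k x) ∣x∣≡N) (necklaceWeight-supported k x-type w₀-min))
          (necklaceWeight-minimalRotation k x-type w₀-min)
    where
    open OfType {x} x-type using () renaming (∣w∣≡N to ∣x∣≡N; ∣w∣≢0 to ∣x∣≢0)
    k : ℕ
    k = proj₁ (minimalRotation x)
    w₀-min : T (isMinRep (rot k x))
    w₀-min = proj₂ (minimalRotation x)

  weight : Word → Word → ℕ
  weight w x = 𝟙 (necklace? w) * (distinguishableBlocks m n w * (𝟙 (hasType? x) * rotationCount w x))

  ∑-weight-row : ∀ w → ∑ (allWords N) (weight w) ≡ N * (𝟙 (necklace? w) * distinguishableBlocks m n w)
  ∑-weight-row w = begin
    ∑ (allWords N) (weight w)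
      ≡⟨ ∑-*ˡ (allWords N) (𝟙 (necklace? w)) _ ⟩
    𝟙 (necklace? w) * ∑[ x ∈ allWords N ] (D w * (𝟙 (hasType? x) * rotationCount w x))
      ≡⟨ cong (𝟙 (necklace? w) *_) (∑-*ˡ (allWords N) (D w) _) ⟩
    𝟙 (necklace? w) * (D w * ∑[ x ∈ allWords N ] (𝟙 (hasType? x) * rotationCount w x))
      ≡⟨ 𝟙-*-cong (necklace? w) (cong (D w *_) ∘ ∑-hasType-rotationCount {w} ∘ proj₁ ∘ Equivalence.to (necklace⇔ w)) ⟩
    𝟙 (necklace? w) * (D w * N)
      ≡⟨ x∙yz≈z∙xy (𝟙 (necklace? w)) (D w) N ⟩
    N * (𝟙 (necklace? w) * D w) ∎
    where
    open ≡-Reasoning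
    open CommSemigroupProperties *-commutativeSemigroup using (x∙yz≈z∙xy)
    D : Word → ℕ
    D = distinguishableBlocks m n

  ∑-weight-column : ∀ x → ∑[ w ∈ allWords N ] weight w x ≡ g * 𝟙 (hasType? x)
  ∑-weight-column x = begin
    ∑[ w ∈ allWords N ] weight w x
      ≡⟨ ∑-cong (allWords N) (λ w → pull-out (𝟙 (necklace? w)) (D w) (𝟙 (hasType? x)) (rotationCount w x)) ⟩
    ∑[ w ∈ allWords N ] (𝟙 (hasType? x) * necklaceWeight x w)
      ≡⟨ ∑-*ˡ (allWords N) (𝟙 (hasType? x)) _ ⟩
    𝟙 (hasType? x) * ∑ (allWords N) (necklaceWeight x)
      ≡⟨ 𝟙-*-cong (hasType? x) (∑-necklaceWeight {x}) ⟩
    𝟙 (hasType? x) * g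
      ≡⟨ *-comm (𝟙 (hasType? x)) g ⟩
    g * 𝟙 (hasType? x) ∎
    where
    open ≡-Reasoning
    open CommSemigroupProperties *-commutativeSemigroup using (x∙yz≈y∙xz)
    D : Word → ℕ
    D = distinguishableBlocks m n
    pull-out : ∀ a b c e → a * (b * (c * e)) ≡ c * (a * (b * e))
    pull-out a b c e = trans (cong (a *_) (x∙yz≈y∙xz b c e)) (x∙yz≈y∙xz a c (b * e))

  markedNecklaceCount-formula : N * markedNecklaceCount m n ≡ g * (N C n)
  markedNecklaceCount-formula = begin
    N * markedNecklaceCount m n
      ≡⟨ cong (N *_) (∑-filter necklace? (allWords N) (distinguishableBlocks m n)) ⟩
    N * ∑[ w ∈ allWords N ] (𝟙 (necklace? w) * distinguishableBlocks m n w)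
      ≡⟨ ∑-doubleCount (allWords N) (allWords N) weight N g ∑-weight-row ∑-weight-column ⟩
    g * ∑[ x ∈ allWords N ] 𝟙 (hasType? x)
      ≡⟨ cong (g *_) (count-hasLengthBlacks N n) ⟩
    g * (N C n) ∎
    where open ≡-Reasoning

theorem3 : (m n : ℕ) → 0 < m → 0 < n →
    (m + n) * markedNecklaceCount m n ≡ gcd m n * ((m + n) C n)
theorem3 m n 0<m _ = Necklaces.markedNecklaceCount-formula m n {{>-nonZero 0<m}}
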